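{- Let $(S,A)$ be a non-negative integer physical model such that $S$ is a recursively enumerable set and each member of $A$ is a partial recursive function whose domain includes all members of $S$. Then $(S,A)$ is isomorphic to some computable physical model.
   Context: A non-negative integer physical model is a pair $(S,A)$ where $S$ is a set of non-negative integers (the states) and each member of $A$ (the observable quantities) is a partial function from the non-negative integers to the non-negative integers. A computable physical model is a pair $(S,A)$ where $S$ is a recursive set of non-negative integers and $A$ is a set of total recursive functions from the non-negative integers to the non-negative integers. Two such models $(S,A)$ and $(T,B)$ are isomorphic iff there exist bijections $\phi:S\to T$ and $\psi:A\to B$ such that $\alpha(s)=\psi(\alpha)(\phi(s))$ for all $s\in S$ and $\alpha\in A$. -}

module Defs where

open import Data.Nat using (ℕ; zero; suc; _<_)
open import Data.Fin using (Fin)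
open import Data.Vec using (Vec; []; _∷_; lookup)
open import Data.Product using (Σ; ∃; _×_; _,_)
open import Data.Sum using (_⊎_)
open import Relation.Nullary using (¬_)
open import Relation.Binary.PropositionalEquality using (_≡_)

data PR : ℕ → Set where
  zer  : ∀ {n} → PR n
  succ : PR 1
  proj : ∀ {n} → Fin n → PR n
  comp : ∀ {m n} → PR m → Vec (PR n) m → PR n
  prec : ∀ {n} → PR n → PR (suc (suc n)) → PR (suc n)
  mu   : ∀ {n} → PR (suc n) → PR n

mutual
  data _⟦_⟧⇓_ : ∀ {n} → PR n → Vec ℕ n → ℕ → Set where
    ev-zer  : ∀ {n} {xs : Vec ℕ n} → zer ⟦ xs ⟧⇓ 0
    ev-succ : ∀ {x} → succ ⟦ x ∷ [] ⟧⇓ suc x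
    ev-proj : ∀ {n} {i : Fin n} {xs} → proj i ⟦ xs ⟧⇓ lookup xs i
    ev-comp : ∀ {m n} {f : PR m} {gs : Vec (PR n) m} {xs ys z} →
              gs ⟦ xs ⟧⇓* ys → f ⟦ ys ⟧⇓ z → comp f gs ⟦ xs ⟧⇓ z
    ev-prec0 : ∀ {n} {g : PR n} {h} {xs z} →
               g ⟦ xs ⟧⇓ z → prec g h ⟦ 0 ∷ xs ⟧⇓ z
    ev-precS : ∀ {n} {g : PR n} {h} {k xs r z} →
               prec g h ⟦ k ∷ xs ⟧⇓ r → h ⟦ k ∷ r ∷ xs ⟧⇓ z →
               prec g h ⟦ suc k ∷ xs ⟧⇓ z
    ev-mu   : ∀ {n} {f : PR (suc n)} {xs k} →
              f ⟦ k ∷ xs ⟧⇓ 0 →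
              (∀ j → j < k → Σ ℕ λ y → f ⟦ j ∷ xs ⟧⇓ suc y) →
              mu f ⟦ xs ⟧⇓ k

  data _⟦_⟧⇓*_ : ∀ {m n} → Vec (PR n) m → Vec ℕ n → Vec ℕ m → Set where
    ev-[] : ∀ {n} {xs : Vec ℕ n} → [] ⟦ xs ⟧⇓* []
    ev-∷  : ∀ {m n} {f : PR n} {fs : Vec (PR n) m} {xs y ys} →
            f ⟦ xs ⟧⇓ y → fs ⟦ xs ⟧⇓* ys → (f ∷ fs) ⟦ xs ⟧⇓* (y ∷ ys)

PRFun : Set
PRFun = PR 1

_↓_ : PRFun → ℕ → Set
α ↓ x = Σ ℕ λ y → α ⟦ x ∷ [] ⟧⇓ y

_≈PR_ : PRFun → PRFun → Set
α ≈PR β = ∀ x y → (α ⟦ x ∷ [] ⟧⇓ y → β ⟦ x ∷ [] ⟧⇓ y) × (β ⟦ x ∷ [] ⟧⇓ y → α ⟦ x ∷ [] ⟧⇓ y)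

RecEnum : (ℕ → Set) → Set
RecEnum S = Σ PRFun λ e → ∀ x → (S x → e ↓ x) × (e ↓ x → S x)

Recursive : (ℕ → Set) → Set
Recursive T = Σ PRFun λ c → ∀ x →
  (T x × c ⟦ x ∷ [] ⟧⇓ 1) ⊎ (¬ T x × c ⟦ x ∷ [] ⟧⇓ 0)

TotalRecursive : (ℕ → ℕ) → Set
TotalRecursive f = Σ PRFun λ c → ∀ x → c ⟦ x ∷ [] ⟧⇓ f x

-- (S , A) with A a set of partial recursive functions, given as a predicate
-- on codes; the set of partial functions is A modulo _≈PR_.
-- (T , B) with B a set of total functions ℕ → ℕ, modulo pointwise equality.

IsComputableModel : (ℕ → Set) → ((ℕ → ℕ) → Set) → Set
IsComputableModel T B = Recursive T × (∀ f → B f → TotalRecursive f)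

-- Isomorphism between (S , A) (A ⊆ partial recursive functions) and (T , B)
-- (B ⊆ total functions): bijections φ : S → T and ψ : A → B (on the
-- underlying sets, i.e. up to equality of naturals / of partial functions /
-- pointwise equality of total functions) with α(s) = ψ(α)(φ(s)).
record Isomorphic (S : ℕ → Set) (A : PRFun → Set)
                  (T : ℕ → Set) (B : (ℕ → ℕ) → Set) : Set where
  field
    φ      : (s : ℕ) → S s → ℕ
    φ-wd   : ∀ s (p q : S s) → φ s p ≡ φ s q
    φ-into : ∀ s (p : S s) → T (φ s p)
    φ-inj  : ∀ s s' (p : S s) (p' : S s') → φ s p ≡ φ s' p' → s ≡ s'
    φ-surj : ∀ t → T t → Σ ℕ λ s → Σ (S s) λ p → φ s p ≡ t
    ψ      : (α : PRFun) → A α → ℕ → ℕ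
    ψ-wd   : ∀ α α' (p : A α) (p' : A α') → α ≈PR α' → ∀ n → ψ α p n ≡ ψ α' p' n
    ψ-into : ∀ α (p : A α) → B (ψ α p)
    ψ-inj  : ∀ α α' (p : A α) (p' : A α') → (∀ n → ψ α p n ≡ ψ α' p' n) → α ≈PR α'
    ψ-surj : ∀ f → B f → Σ PRFun λ α → Σ (A α) λ p → ∀ n → ψ α p n ≡ f n
    compat : ∀ α (p : A α) s (q : S s) → α ⟦ s ∷ [] ⟧⇓ ψ α p (φ s q)

module Submission where

-- Let e be a code whose domain is S.  The step-indexed evaluator eval f k xs
-- (0 = no result with fuel k, suc y = result y) is itself computable, sound
-- and complete for the big-step semantics, and monotone in the fuel.  A state
-- s is replaced by 1 + ⟨ s , t ⟩ with t the least fuel with which e halts on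
-- s; the set T of these codes is recursive, since membership is a bounded
-- check of eval on e.  An observable α becomes ψ α, which on 1 + ⟨ s , t ⟩ ∈ T
-- returns α(s) and off T returns the least code of a term extensionally equal
-- to α, so that ψ is injective on extensional classes; ψ α is computed by
-- branching on the characteristic function of T and running α on the decoded
-- state.

open import Defs
open import Level using (0ℓ)
open import Axiom.ExcludedMiddle using (ExcludedMiddle)
open import Data.Nat using (ℕ; zero; suc; _+_; _*_; _∸_; _<_; _≤_; _≤′_; ≤′-refl; ≤′-step; z≤n; s≤s; pred; _⊔_)
open import Data.Nat.Properties
open import Data.Fin using (Fin; zero; suc; toℕ)
open import Data.Fin.Properties using (toℕ-injective)
open import Data.Vec using (Vec; []; _∷_; lookup; head; tail; tabulate; map)
open import Data.Vec.Properties using (tabulate∘lookup)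
open import Data.Product using (Σ; _×_; _,_; proj₁; proj₂)
open import Data.Sum using (_⊎_; inj₁; inj₂) renaming (map to map-⊎)
open import Data.Empty using (⊥-elim)
open import Relation.Nullary using (¬_; Dec; yes; no)
open import Relation.Binary using (tri<; tri≈; tri>)
open import Relation.Binary.PropositionalEquality

Computable : (n : ℕ) → (Vec ℕ n → ℕ) → Set
Computable n f = Σ (PR n) λ c → ∀ xs → c ⟦ xs ⟧⇓ f xs

ComputableVec : (n m : ℕ) → (Vec ℕ n → Vec ℕ m) → Set
ComputableVec n m F = Σ (Vec (PR n) m) λ cs → ∀ xs → cs ⟦ xs ⟧⇓* F xs

computable-ext : ∀ {n f g} → (∀ xs → f xs ≡ g xs) → Computable n f → Computable n g
computable-ext f≗g (c , c⇓) = c , λ xs → subst (c ⟦ xs ⟧⇓_) (f≗g xs) (c⇓ xs)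

zeroC : ∀ {n} → Computable n (λ _ → 0)
zeroC = zer , λ _ → ev-zer

succC : Computable 1 (λ xs → suc (head xs))
succC = succ , λ { (x ∷ []) → ev-succ }

projC : ∀ {n} (i : Fin n) → Computable n (λ xs → lookup xs i)
projC i = proj i , λ _ → ev-proj

nilC : ∀ {n} → ComputableVec n 0 (λ _ → [])
nilC = [] , λ _ → ev-[]

consC : ∀ {n m g G} → Computable n g → ComputableVec n m G →
        ComputableVec n (suc m) (λ xs → g xs ∷ G xs)
consC (c , c⇓) (cs , cs⇓) = c ∷ cs , λ xs → ev-∷ (c⇓ xs) (cs⇓ xs)

compC : ∀ {n m f G} → Computable m f → ComputableVec n m G → Computable n (λ xs → f (G xs))
compC (c , c⇓) (cs , cs⇓) = comp c cs , λ xs → ev-comp (cs⇓ xs) (c⇓ _)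

compose₁ : ∀ {n f g₁} → Computable 1 f → Computable n g₁ →
           Computable n (λ xs → f (g₁ xs ∷ []))
compose₁ f g₁ = compC f (consC g₁ nilC)

compose₂ : ∀ {n f g₁ g₂} → Computable 2 f → Computable n g₁ → Computable n g₂ →
           Computable n (λ xs → f (g₁ xs ∷ g₂ xs ∷ []))
compose₂ f g₁ g₂ = compC f (consC g₁ (consC g₂ nilC))

compose₃ : ∀ {n f g₁ g₂ g₃} → Computable 3 f → Computable n g₁ → Computable n g₂ →
           Computable n g₃ → Computable n (λ xs → f (g₁ xs ∷ g₂ xs ∷ g₃ xs ∷ []))
compose₃ f g₁ g₂ g₃ = compC f (consC g₁ (consC g₂ (consC g₃ nilC)))

selectC : ∀ {n n'} (ρ : Fin n → Fin n') → ComputableVec n' n (λ v → tabulate (λ i → lookup v (ρ i)))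
selectC {zero} ρ = nilC
selectC {suc n} ρ = consC (projC (ρ zero)) (selectC (λ i → ρ (suc i)))

primRec : ∀ {n} → (Vec ℕ n → ℕ) → (Vec ℕ (suc (suc n)) → ℕ) → ℕ → Vec ℕ n → ℕ
primRec g h zero ys = g ys
primRec g h (suc k) ys = h (k ∷ primRec g h k ys ∷ ys)

precC : ∀ {n g h} → Computable n g → Computable (suc (suc n)) h →
        Computable (suc n) (λ xs → primRec g h (head xs) (tail xs))
precC {n} {g} {h} (cg , cg⇓) (ch , ch⇓) = prec cg ch , λ { (x ∷ xs) → prec⇓ x xs }
  where
  prec⇓ : ∀ x xs → prec cg ch ⟦ x ∷ xs ⟧⇓ primRec g h x xs
  prec⇓ zero xs = ev-prec0 (cg⇓ xs)
  prec⇓ (suc x) xs = ev-precS (prec⇓ x xs) (ch⇓ _)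

constC : ∀ {n} (m : ℕ) → Computable n (λ _ → m)
constC zero = zeroC
constC (suc m) = compose₁ succC (constC m)

addC : Computable 2 (λ v → head v + head (tail v))
addC = computable-ext (λ { (x ∷ y ∷ []) → rec≡+ x y })
  (precC {g = λ v → lookup v zero} {h = λ v → suc (lookup v (suc zero))}
         (projC zero) (compose₁ succC (projC (suc zero))))
  where
  rec≡+ : ∀ x y → primRec (λ v → lookup v zero) (λ v → suc (lookup v (suc zero))) x (y ∷ []) ≡ x + y
  rec≡+ zero y = refl
  rec≡+ (suc x) y = cong suc (rec≡+ x y)

mulC : Computable 2 (λ v → head v * head (tail v))
mulC = computable-ext (λ { (x ∷ y ∷ []) → rec≡* x y })
  (precC {g = λ _ → 0} {h = λ v → lookup v (suc (suc zero)) + lookup v (suc zero)}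
         zeroC (compose₂ addC (projC (suc (suc zero))) (projC (suc zero))))
  where
  rec≡* : ∀ x y → primRec (λ _ → 0) (λ v → lookup v (suc (suc zero)) + lookup v (suc zero)) x (y ∷ []) ≡ x * y
  rec≡* zero y = refl
  rec≡* (suc x) y = cong (y +_) (rec≡* x y)

predC : Computable 1 (λ v → pred (head v))
predC = computable-ext (λ { (zero ∷ []) → refl ; (suc x ∷ []) → refl })
  (precC {g = λ _ → 0} {h = λ v → lookup v zero} zeroC (projC zero))

monusC : Computable 2 (λ v → head v ∸ head (tail v))
monusC = computable-ext (λ { (x ∷ y ∷ []) → rec≡∸ x y })
  (compose₂ (precC {g = λ v → lookup v zero} {h = λ v → pred (lookup v (suc zero))}
                   (projC zero) (compose₁ predC (projC (suc zero))))
            (projC (suc zero)) (projC zero))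
  where
  rec≡∸ : ∀ x y → primRec (λ v → lookup v zero) (λ v → pred (lookup v (suc zero))) y (x ∷ []) ≡ x ∸ y
  rec≡∸ x zero = refl
  rec≡∸ x (suc y) = trans (cong pred (rec≡∸ x y)) (pred[m∸n]≡m∸[1+n] x y)

if0 : ℕ → ℕ → ℕ → ℕ
if0 zero a b = a
if0 (suc _) a b = b

if0C : Computable 3 (λ v → if0 (head v) (head (tail v)) (head (tail (tail v))))
if0C = computable-ext (λ { (zero ∷ a ∷ b ∷ []) → refl ; (suc c ∷ a ∷ b ∷ []) → refl })
  (precC {g = λ v → lookup v zero} {h = λ v → lookup v (suc (suc (suc zero)))}
         (projC zero) (projC (suc (suc (suc zero)))))

ifZeroC : ∀ {n c a b} → Computable n c → Computable n a → Computable n b →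
          Computable n (λ xs → if0 (c xs) (a xs) (b xs))
ifZeroC = compose₃ if0C

sg : ℕ → ℕ
sg x = if0 x 0 1

sgC : Computable 1 (λ v → sg (lookup v zero))
sgC = ifZeroC (projC zero) (constC 0) (constC 1)

sumTo : ℕ → (ℕ → ℕ) → ℕ
sumTo zero f = 0
sumTo (suc N) f = sumTo N f + f N

sumC : ∀ {n} {F : ℕ → Vec ℕ n → ℕ} → Computable (suc n) (λ v → F (head v) (tail v)) →
       Computable (suc n) (λ v → sumTo (head v) (λ i → F i (tail v)))
sumC {n} {F} FC = computable-ext (λ { (N ∷ xs) → rec≡sum N xs }) (precC {g = λ _ → 0} {h = addTerm} zeroC addTermC)
  where
  -- arguments (index , partial sum , parameters)
  addTerm : Vec ℕ (suc (suc n)) → ℕ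
  addTerm v = lookup v (suc zero) + F (lookup v zero) (tabulate (λ i → lookup v (suc (suc i))))
  addTermC : Computable (suc (suc n)) addTerm
  addTermC = compose₂ addC (projC (suc zero)) (compC FC (consC (projC zero) (selectC (λ i → suc (suc i)))))
  rec≡sum : ∀ N xs → primRec (λ _ → 0) addTerm N xs ≡ sumTo N (λ i → F i xs)
  rec≡sum zero xs = refl
  rec≡sum (suc N) xs rewrite rec≡sum N xs | tabulate∘lookup xs = refl

-- A step-indexed evaluator
--
-- eval f k xs is 0 if the run of f on xs has not finished with fuel k, and
-- suc y if it has finished with result y.  Fuel is only consumed by
-- minimisation, which inspects the candidates 0 … k-1.

allHalted : ∀ {m} → Vec ℕ m → ℕ
allHalted [] = 1
allHalted (x ∷ xs) = sg x * allHalted xs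

-- One step of the search for the least root: in state 1 ("still searching")
-- the candidate c with evaluation v is accepted (state 2 + c) if v = 1,
-- rejected (state 1) if v ≥ 2, and the search aborts (state 0) if v = 0.
-- States 0 and ≥ 2 are final.
searchStep : ℕ → ℕ → ℕ → ℕ
searchStep s c v = if0 s 0 (if0 (pred s) (if0 v 0 (if0 (pred v) (suc (suc c)) 1)) s)

mutual
  eval : ∀ {n} → PR n → ℕ → Vec ℕ n → ℕ
  eval zer k xs = 1
  eval succ k xs = suc (suc (head xs))
  eval (proj i) k xs = suc (lookup xs i)
  eval (comp f gs) k xs = allHalted (evals gs k xs) * eval f k (map pred (evals gs k xs))
  eval (prec g h) k xs = evalRec g h k (head xs) (tail xs)
  eval (mu f) k xs = search f k k xs ∸ 1

  evals : ∀ {n m} → Vec (PR n) m → ℕ → Vec ℕ n → Vec ℕ m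
  evals [] k xs = []
  evals (g ∷ gs) k xs = eval g k xs ∷ evals gs k xs

  evalRec : ∀ {n} → PR n → PR (suc (suc n)) → ℕ → ℕ → Vec ℕ n → ℕ
  evalRec g h k zero xs = eval g k xs
  evalRec g h k (suc j) xs = sg (evalRec g h k j xs) * eval h k (j ∷ pred (evalRec g h k j xs) ∷ xs)

  search : ∀ {n} → PR (suc n) → ℕ → ℕ → Vec ℕ n → ℕ
  search f k zero xs = 1
  search f k (suc c) xs = searchStep (search f k c xs) c (eval f k (c ∷ xs))

mapPred⇓ : ∀ {n m} {cs : Vec (PR n) m} {xs ys} → cs ⟦ xs ⟧⇓* ys →
           map (λ c → comp (proj₁ predC) (c ∷ [])) cs ⟦ xs ⟧⇓* map pred ys
mapPred⇓ ev-[] = ev-[]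
mapPred⇓ (ev-∷ d ds) = ev-∷ (ev-comp (ev-∷ d ev-[]) (proj₂ predC _)) (mapPred⇓ ds)

mapPredC : ∀ {n m G} → ComputableVec n m G → ComputableVec n m (λ xs → map pred (G xs))
mapPredC (cs , cs⇓) = _ , λ xs → mapPred⇓ (cs⇓ xs)

allHaltedCode : ∀ {n m} → Vec (PR n) m → PR n
allHaltedCode [] = proj₁ (constC 1)
allHaltedCode (c ∷ cs) = comp (proj₁ mulC) (comp (proj₁ sgC) (c ∷ []) ∷ allHaltedCode cs ∷ [])

allHalted⇓ : ∀ {n m} {cs : Vec (PR n) m} {xs ys} → cs ⟦ xs ⟧⇓* ys → allHaltedCode cs ⟦ xs ⟧⇓ allHalted ys
allHalted⇓ {xs = xs} ev-[] = proj₂ (constC 1) xs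
allHalted⇓ (ev-∷ d ds) =
  ev-comp (ev-∷ (ev-comp (ev-∷ d ev-[]) (proj₂ sgC _)) (ev-∷ (allHalted⇓ ds) ev-[])) (proj₂ mulC _)

allHaltedC : ∀ {n m G} → ComputableVec n m G → Computable n (λ xs → allHalted (G xs))
allHaltedC (cs , cs⇓) = allHaltedCode cs , λ xs → allHalted⇓ (cs⇓ xs)

searchStepC : Computable 3 (λ v → searchStep (lookup v zero) (lookup v (suc zero)) (lookup v (suc (suc zero))))
searchStepC = ifZeroC s (constC 0)
  (ifZeroC (compose₁ predC s)
     (ifZeroC v (constC 0) (ifZeroC (compose₁ predC v) (compose₁ succC (compose₁ succC c)) (constC 1)))
     s)
  where
  s : Computable 3 (λ w → lookup w zero)
  s = projC zero
  c : Computable 3 (λ w → lookup w (suc zero))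
  c = projC (suc zero)
  v : Computable 3 (λ w → lookup w (suc (suc zero)))
  v = projC (suc (suc zero))

-- the step functions of the primitive recursions unfolding evalRec and search,
-- with arguments (counter , accumulator , fuel , parameters)
evalRecStep : ∀ {n} → PR (suc (suc n)) → Vec ℕ (suc (suc (suc n))) → ℕ
evalRecStep h v = sg (lookup v (suc zero)) * eval h (lookup v (suc (suc zero)))
  (lookup v zero ∷ pred (lookup v (suc zero)) ∷ tabulate (λ i → lookup v (suc (suc (suc i)))))

searchStepAt : ∀ {n} → PR (suc n) → Vec ℕ (suc (suc (suc n))) → ℕ
searchStepAt f v = searchStep (lookup v (suc zero)) (lookup v zero)
  (eval f (lookup v (suc (suc zero))) (lookup v zero ∷ tabulate (λ i → lookup v (suc (suc (suc i))))))

evalRec≡primRec : ∀ {n} (g : PR n) h k x xs →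
  primRec (λ v → eval g (head v) (tail v)) (evalRecStep h) x (k ∷ xs) ≡ evalRec g h k x xs
evalRec≡primRec g h k zero xs = refl
evalRec≡primRec g h k (suc x) xs rewrite evalRec≡primRec g h k x xs | tabulate∘lookup xs = refl

search≡primRec : ∀ {n} (f : PR (suc n)) k c xs → primRec (λ _ → 1) (searchStepAt f) c (k ∷ xs) ≡ search f k c xs
search≡primRec f k zero xs = refl
search≡primRec f k (suc c) xs rewrite search≡primRec f k c xs | tabulate∘lookup xs = refl

swap01 : ∀ {n} → Fin (suc (suc n)) → Fin (suc (suc n))
swap01 zero = suc zero
swap01 (suc zero) = zero
swap01 (suc (suc i)) = suc (suc i)

mutual
  eval-computable : ∀ {n} (f : PR n) → Computable (suc n) (λ v → eval f (head v) (tail v))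
  eval-computable zer = computable-ext (λ { (k ∷ xs) → refl }) (constC 1)
  eval-computable succ = computable-ext (λ { (k ∷ x ∷ []) → refl })
    (compose₁ succC (compose₁ succC (projC (suc zero))))
  eval-computable (proj i) = computable-ext (λ { (k ∷ xs) → refl }) (compose₁ succC (projC (suc i)))
  eval-computable (comp f gs) = computable-ext (λ { (k ∷ xs) → refl })
    (compose₂ mulC (allHaltedC (evals-computable gs))
                   (compC (eval-computable f) (consC (projC zero) (mapPredC (evals-computable gs)))))
  eval-computable {suc n} (prec g h) = computable-ext
      (λ { (k ∷ x ∷ xs) → trans (cong (λ ys → primRec (λ v → eval g (head v) (tail v)) (evalRecStep h) x (k ∷ ys)) (tabulate∘lookup xs))
                                (evalRec≡primRec g h k x xs) })
      (compC (precC (eval-computable g) stepC) (selectC swap01))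
    where
    stepC : Computable (suc (suc (suc n))) (evalRecStep h)
    stepC = compose₂ mulC (compose₁ sgC (projC (suc zero)))
      (compC (eval-computable h) (consC (projC (suc (suc zero))) (consC (projC zero)
        (consC (compose₁ predC (projC (suc zero))) (selectC (λ i → suc (suc (suc i))))))))
  eval-computable {n} (mu f) = computable-ext
      (λ { (k ∷ xs) → cong (_∸ 1) (trans (cong (λ ys → primRec (λ _ → 1) (searchStepAt f) k ys) (tabulate∘lookup (k ∷ xs)))
                                         (search≡primRec f k k xs)) })
      (compose₂ monusC (compC (precC {g = λ _ → 1} (constC 1) stepC) (consC (projC zero) (selectC (λ i → i)))) (constC 1))
    where
    stepC : Computable (suc (suc (suc n))) (searchStepAt f)
    stepC = compose₃ searchStepC (projC (suc zero)) (projC zero)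
      (compC (eval-computable f) (consC (projC (suc (suc zero)))
        (consC (projC zero) (selectC (λ i → suc (suc (suc i)))))))

  evals-computable : ∀ {n m} (gs : Vec (PR n) m) → ComputableVec (suc n) m (λ v → evals gs (head v) (tail v))
  evals-computable [] = nilC
  evals-computable (g ∷ gs) = consC (eval-computable g) (evals-computable gs)

sg-*-suc : ∀ x b y → sg x * b ≡ suc y → Σ ℕ (λ x' → x ≡ suc x') × b ≡ suc y
sg-*-suc (suc x) b y eq = (x , refl) , trans (sym (+-identityʳ b)) eq

allHalted-*-suc : ∀ {m} (rs : Vec ℕ m) b y → allHalted rs * b ≡ suc y →
                  Σ (Vec ℕ m) (λ ys → rs ≡ map suc ys) × b ≡ suc y
allHalted-*-suc [] b y eq = ([] , refl) , trans (sym (+-identityʳ b)) eq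
allHalted-*-suc (r ∷ rs) b y eq with sg-*-suc r (allHalted rs * b) y (trans (sym (*-assoc (sg r) (allHalted rs) b)) eq)
... | (r' , refl) , eq′ with allHalted-*-suc rs b y eq′
... | (ys , refl) , eq″ = (r' ∷ ys , refl) , eq″

allHalted-suc : ∀ {m} (ys : Vec ℕ m) → allHalted (map suc ys) ≡ 1
allHalted-suc [] = refl
allHalted-suc (y ∷ ys) rewrite allHalted-suc ys = refl

map-pred-suc : ∀ {m} (ys : Vec ℕ m) → map pred (map suc ys) ≡ ys
map-pred-suc [] = refl
map-pred-suc (y ∷ ys) = cong (y ∷_) (map-pred-suc ys)

eval-comp : ∀ {n m} (f : PR m) (gs : Vec (PR n) m) k xs ys →
            evals gs k xs ≡ map suc ys → eval (comp f gs) k xs ≡ eval f k ys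
eval-comp f gs k xs ys eq rewrite eq | allHalted-suc ys | map-pred-suc ys = +-identityʳ _

eval-head : ∀ {n m} (f : PR m) (gs : Vec (PR n) m) k xs ys b → evals gs k xs ≡ map suc ys →
            b ≡ eval f k (map pred (evals gs k xs)) → b ≡ eval f k ys
eval-head f gs k xs ys b eq b≡ = trans b≡ (cong (eval f k) (trans (cong (map pred) eq) (map-pred-suc ys)))

evalRec-step : ∀ {n} (g : PR n) h k j xs r z → evalRec g h k j xs ≡ suc r → eval h k (j ∷ r ∷ xs) ≡ suc z →
               evalRec g h k (suc j) xs ≡ suc z
evalRec-step g h k j xs r z rec≡ h≡ rewrite rec≡ = trans (+-identityʳ _) h≡

mutual
  eval-sound : ∀ {n} (f : PR n) k xs y → eval f k xs ≡ suc y → f ⟦ xs ⟧⇓ y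
  eval-sound zer k xs .0 refl = ev-zer
  eval-sound succ k (x ∷ []) .(suc x) refl = ev-succ
  eval-sound (proj i) k xs .(lookup xs i) refl = ev-proj
  eval-sound (comp f gs) k xs y eq with allHalted-*-suc (evals gs k xs) _ y eq
  ... | (ys , gs≡) , f≡ = ev-comp (evals-sound gs k xs ys gs≡)
                                  (eval-sound f k ys y (sym (eval-head f gs k xs ys _ gs≡ (sym f≡))))
  eval-sound (prec g h) k (x ∷ xs) y eq = evalRec-sound g h k x xs y eq
  eval-sound (mu f) k xs y eq =
    let (root , nonroots) = search-found-sound f k k xs y (∸1≡ (search f k k xs) eq) in ev-mu root nonroots
    where
    ∸1≡ : ∀ s → s ∸ 1 ≡ suc y → s ≡ suc (suc y)
    ∸1≡ (suc s) eq = cong suc eq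

  evals-sound : ∀ {n m} (gs : Vec (PR n) m) k xs ys → evals gs k xs ≡ map suc ys → gs ⟦ xs ⟧⇓* ys
  evals-sound [] k xs [] eq = ev-[]
  evals-sound (g ∷ gs) k xs (y ∷ ys) eq =
    ev-∷ (eval-sound g k xs y (cong head eq)) (evals-sound gs k xs ys (cong tail eq))

  evalRec-sound : ∀ {n} (g : PR n) h k x xs y → evalRec g h k x xs ≡ suc y → prec g h ⟦ x ∷ xs ⟧⇓ y
  evalRec-sound g h k zero xs y eq = ev-prec0 (eval-sound g k xs y eq)
  evalRec-sound g h k (suc x) xs y eq with sg-*-suc (evalRec g h k x xs) _ y eq
  ... | (r , rec≡) , h≡ = ev-precS (evalRec-sound g h k x xs r rec≡)
          (eval-sound h k (x ∷ r ∷ xs) y (trans (cong (λ z → eval h k (x ∷ pred z ∷ xs)) (sym rec≡)) h≡))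

  search-searching-sound : ∀ {n} (f : PR (suc n)) k c xs → search f k c xs ≡ 1 →
                           ∀ j → j < c → Σ ℕ λ w → f ⟦ j ∷ xs ⟧⇓ suc w
  search-searching-sound f k (suc c) xs eq j j<1+c with search f k c xs in s≡ | eval f k (c ∷ xs) in v≡
  search-searching-sound f k (suc c) xs () j j<1+c | zero | _
  search-searching-sound f k (suc c) xs () j j<1+c | suc zero | zero
  search-searching-sound f k (suc c) xs () j j<1+c | suc zero | suc zero
  search-searching-sound f k (suc c) xs eq j j<1+c | suc zero | suc (suc w) with m≤n⇒m<n∨m≡n (≤-pred j<1+c)
  ... | inj₁ j<c = search-searching-sound f k c xs s≡ j j<c
  ... | inj₂ refl = w , eval-sound f k (j ∷ xs) (suc w) v≡
  search-searching-sound f k (suc c) xs () j j<1+c | suc (suc s) | _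

  search-found-sound : ∀ {n} (f : PR (suc n)) k c xs j → search f k c xs ≡ suc (suc j) →
                       (f ⟦ j ∷ xs ⟧⇓ 0) × (∀ j' → j' < j → Σ ℕ λ w → f ⟦ j' ∷ xs ⟧⇓ suc w)
  search-found-sound f k (suc c) xs j eq with search f k c xs in s≡ | eval f k (c ∷ xs) in v≡
  search-found-sound f k (suc c) xs j () | zero | _
  search-found-sound f k (suc c) xs j () | suc zero | zero
  search-found-sound f k (suc c) xs .c refl | suc zero | suc zero =
    eval-sound f k (c ∷ xs) 0 v≡ , search-searching-sound f k c xs s≡
  search-found-sound f k (suc c) xs j () | suc zero | suc (suc w)
  search-found-sound f k (suc c) xs j refl | suc (suc s) | _ = search-found-sound f k c xs j s≡

mutual
  eval-mono : ∀ {n} (f : PR n) k xs y → eval f k xs ≡ suc y → eval f (suc k) xs ≡ suc y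
  eval-mono zer k xs y eq = eq
  eval-mono succ k xs y eq = eq
  eval-mono (proj i) k xs y eq = eq
  eval-mono (comp f gs) k xs y eq with allHalted-*-suc (evals gs k xs) _ y eq
  ... | (ys , gs≡) , f≡ = trans (eval-comp f gs (suc k) xs ys (evals-mono gs k xs ys gs≡))
                                (eval-mono f k ys y (sym (eval-head f gs k xs ys _ gs≡ (sym f≡))))
  eval-mono (prec g h) k (x ∷ xs) y eq = evalRec-mono g h k x xs y eq
  eval-mono (mu f) k xs y eq with search f k k xs in s≡
  eval-mono (mu f) k xs y () | zero
  eval-mono (mu f) k xs y () | suc zero
  eval-mono (mu f) k xs y eq | suc (suc j) rewrite search-mono f k k xs (suc j) s≡ = eq

  evals-mono : ∀ {n m} (gs : Vec (PR n) m) k xs ys → evals gs k xs ≡ map suc ys → evals gs (suc k) xs ≡ map suc ys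
  evals-mono [] k xs [] eq = refl
  evals-mono (g ∷ gs) k xs (y ∷ ys) eq =
    cong₂ _∷_ (eval-mono g k xs y (cong head eq)) (evals-mono gs k xs ys (cong tail eq))

  evalRec-mono : ∀ {n} (g : PR n) h k x xs y → evalRec g h k x xs ≡ suc y → evalRec g h (suc k) x xs ≡ suc y
  evalRec-mono g h k zero xs y eq = eval-mono g k xs y eq
  evalRec-mono g h k (suc x) xs y eq with evalRec g h k x xs in rec≡
  evalRec-mono g h k (suc x) xs y () | zero
  evalRec-mono g h k (suc x) xs y eq | suc r rewrite evalRec-mono g h k x xs r rec≡ =
    trans (+-identityʳ _) (eval-mono h k (x ∷ r ∷ xs) y (trans (sym (+-identityʳ _)) eq))

  -- every nonzero search state persists when the fuel grows; only an aborted
  -- search (state 0) may change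
  search-mono : ∀ {n} (f : PR (suc n)) k c xs t → search f k c xs ≡ suc t → search f (suc k) c xs ≡ suc t
  search-mono f k zero xs t eq = eq
  search-mono f k (suc c) xs t eq with search f k c xs in s≡ | eval f k (c ∷ xs) in v≡
  search-mono f k (suc c) xs t () | zero | _
  search-mono f k (suc c) xs t () | suc zero | zero
  search-mono f k (suc c) xs t eq | suc zero | suc v
    rewrite search-mono f k c xs 0 s≡ | eval-mono f k (c ∷ xs) v v≡ = eq
  search-mono f k (suc c) xs t eq | suc (suc s) | _ rewrite search-mono f k c xs (suc s) s≡ = eq

eval-mono-≤ : ∀ {n} (f : PR n) {k k' xs y} → k ≤ k' → eval f k xs ≡ suc y → eval f k' xs ≡ suc y
eval-mono-≤ f le = go (≤⇒≤′ le)
  where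
  go : ∀ {k k' xs y} → k ≤′ k' → eval f k xs ≡ suc y → eval f k' xs ≡ suc y
  go ≤′-refl eq = eq
  go (≤′-step le) eq = eval-mono f _ _ _ (go le eq)

evals-mono-≤ : ∀ {n m} (gs : Vec (PR n) m) {k k' xs ys} → k ≤ k' → evals gs k xs ≡ map suc ys →
               evals gs k' xs ≡ map suc ys
evals-mono-≤ [] {ys = []} le eq = refl
evals-mono-≤ (g ∷ gs) {ys = y ∷ ys} le eq =
  cong₂ _∷_ (eval-mono-≤ g le (cong head eq)) (evals-mono-≤ gs le (cong tail eq))

search-stays : ∀ {n} (f : PR (suc n)) K c xs j → search f K c xs ≡ suc (suc j) →
               ∀ c' → c ≤ c' → search f K c' xs ≡ suc (suc j)
search-stays f K c xs j eq c' c≤c' = go (≤⇒≤′ c≤c')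
  where
  go : ∀ {c'} → c ≤′ c' → search f K c' xs ≡ suc (suc j)
  go ≤′-refl = eq
  go (≤′-step le) rewrite go le = refl

search-searching : ∀ {n} (f : PR (suc n)) K c xs →
                   (∀ j → j < c → Σ ℕ λ w → eval f K (j ∷ xs) ≡ suc (suc w)) → search f K c xs ≡ 1
search-searching f K zero xs nonroots = refl
search-searching f K (suc c) xs nonroots
  with nonroots c ≤-refl | search-searching f K c xs (λ j j<c → nonroots j (m<n⇒m<1+n j<c))
... | (w , eq) | s≡1 rewrite s≡1 | eq = refl

search-finds : ∀ {n} (f : PR (suc n)) K k xs → search f K k xs ≡ 1 → eval f K (k ∷ xs) ≡ 1 →
               search f K (suc k) xs ≡ suc (suc k)
search-finds f K k xs s≡1 v≡1 rewrite s≡1 | v≡1 = refl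

mutual
  eval-complete : ∀ {n} {f : PR n} {xs y} → f ⟦ xs ⟧⇓ y → Σ ℕ λ k → eval f k xs ≡ suc y
  eval-complete ev-zer = 0 , refl
  eval-complete ev-succ = 0 , refl
  eval-complete ev-proj = 0 , refl
  eval-complete (ev-comp {f = f} {gs = gs} {xs = xs} {ys = ys} ds d) with evals-complete ds | eval-complete d
  ... | (k₁ , eq₁) | (k₂ , eq₂) = k₁ ⊔ k₂ ,
    trans (eval-comp f gs _ xs ys (evals-mono-≤ gs (m≤m⊔n k₁ k₂) eq₁)) (eval-mono-≤ f (m≤n⊔m k₁ k₂) eq₂)
  eval-complete (ev-prec0 d) = eval-complete d
  eval-complete (ev-precS {g = g} {h = h} {k = j} {xs = xs} d₁ d₂) with eval-complete d₁ | eval-complete d₂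
  ... | (k₁ , eq₁) | (k₂ , eq₂) = k₁ ⊔ k₂ ,
    evalRec-step g h _ j xs _ _ (eval-mono-≤ (prec g h) {xs = j ∷ xs} (m≤m⊔n k₁ k₂) eq₁) (eval-mono-≤ h (m≤n⊔m k₁ k₂) eq₂)
  eval-complete (ev-mu {f = f} {xs = xs} {k = k} d₀ nonroots) = K ,
      cong (_∸ 1) (search-stays f K (suc k) xs k found K k<K)
    where
    nonrootFuel : ∀ c → c ≤ k → Σ ℕ λ K → ∀ j → j < c → Σ ℕ λ w → eval f K (j ∷ xs) ≡ suc (suc w)
    nonrootFuel zero _ = 0 , λ j ()
    nonrootFuel (suc c) c<k with nonrootFuel c (<⇒≤ c<k) | eval-complete (proj₂ (nonroots c c<k))
    ... | (K₁ , below) | (K₂ , at) = K₁ ⊔ K₂ , λ j j<1+c → case j (m≤n⇒m<n∨m≡n (≤-pred j<1+c))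
      where
      case : ∀ j → j < c ⊎ j ≡ c → Σ ℕ λ w → eval f (K₁ ⊔ K₂) (j ∷ xs) ≡ suc (suc w)
      case j (inj₁ j<c) = let (w , eq) = below j j<c in w , eval-mono-≤ f (m≤m⊔n K₁ K₂) eq
      case j (inj₂ refl) = _ , eval-mono-≤ f (m≤n⊔m K₁ K₂) at
    -- fuel for the non-roots, for the root k, and for inspecting k + 1 candidates
    K₁ K₀ K : ℕ
    K₁ = proj₁ (nonrootFuel k ≤-refl)
    K₀ = proj₁ (eval-complete d₀)
    K = (K₁ ⊔ K₀) ⊔ suc k
    k<K : suc k ≤ K
    k<K = m≤n⊔m (K₁ ⊔ K₀) (suc k)
    found : search f K (suc k) xs ≡ suc (suc k)
    found = search-finds f K k xs
      (search-searching f K k xs (λ j j<k →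
         let (w , eq) = proj₂ (nonrootFuel k ≤-refl) j j<k
         in w , eval-mono-≤ f (≤-trans (m≤m⊔n K₁ K₀) (m≤m⊔n _ (suc k))) eq))
      (eval-mono-≤ f (≤-trans (m≤n⊔m K₁ K₀) (m≤m⊔n _ (suc k))) (proj₂ (eval-complete d₀)))

  evals-complete : ∀ {n m} {gs : Vec (PR n) m} {xs ys} → gs ⟦ xs ⟧⇓* ys → Σ ℕ λ k → evals gs k xs ≡ map suc ys
  evals-complete ev-[] = 0 , refl
  evals-complete (ev-∷ {f = g} {fs = gs} d ds) with eval-complete d | evals-complete ds
  ... | (k₁ , eq₁) | (k₂ , eq₂) =
    k₁ ⊔ k₂ , cong₂ _∷_ (eval-mono-≤ g (m≤m⊔n k₁ k₂) eq₁) (evals-mono-≤ gs (m≤n⊔m k₁ k₂) eq₂)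

mutual
  ⇓-deterministic : ∀ {n} {f : PR n} {xs y y'} → f ⟦ xs ⟧⇓ y → f ⟦ xs ⟧⇓ y' → y ≡ y'
  ⇓-deterministic ev-zer ev-zer = refl
  ⇓-deterministic ev-succ ev-succ = refl
  ⇓-deterministic ev-proj ev-proj = refl
  ⇓-deterministic (ev-comp ds d) (ev-comp ds' d') with ⇓*-deterministic ds ds'
  ... | refl = ⇓-deterministic d d'
  ⇓-deterministic (ev-prec0 d) (ev-prec0 d') = ⇓-deterministic d d'
  ⇓-deterministic (ev-precS d₁ d₂) (ev-precS d₁' d₂') with ⇓-deterministic d₁ d₁'
  ... | refl = ⇓-deterministic d₂ d₂'
  ⇓-deterministic (ev-mu {k = k} d₀ nonroots) (ev-mu {k = k'} d₀' nonroots') with <-cmp k k'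
  ... | tri< k<k' _ _ = ⊥-elim (0≢1+n (⇓-deterministic d₀ (proj₂ (nonroots' k k<k'))))
  ... | tri≈ _ k≡k' _ = k≡k'
  ... | tri> _ _ k'<k = ⊥-elim (0≢1+n (⇓-deterministic d₀' (proj₂ (nonroots k' k'<k))))

  ⇓*-deterministic : ∀ {n m} {gs : Vec (PR n) m} {xs ys ys'} → gs ⟦ xs ⟧⇓* ys → gs ⟦ xs ⟧⇓* ys' → ys ≡ ys'
  ⇓*-deterministic ev-[] ev-[] = refl
  ⇓*-deterministic (ev-∷ d ds) (ev-∷ d' ds') = cong₂ _∷_ (⇓-deterministic d d') (⇓*-deterministic ds ds')

-- Pairing, and decoding by bounded sums

-- ⟨ s , t ⟩ = (s + t)² + s, an injective pairing function (kept opaque so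
-- that goals mentioning it stay small)
opaque
  ⟨_,_⟩ : ℕ → ℕ → ℕ
  ⟨ s , t ⟩ = (s + t) * (s + t) + s

  ⟨,⟩-def : ∀ s t → ⟨ s , t ⟩ ≡ (s + t) * (s + t) + s
  ⟨,⟩-def s t = refl

  -- squares of consecutive sums are far enough apart
  square+offset< : ∀ n n' s → s ≤ n → n < n' → n * n + s < n' * n'
  square+offset< n n' s s≤n n<n' = begin-strict
      n * n + s       ≤⟨ +-monoʳ-≤ (n * n) s≤n ⟩
      n * n + n       ≡⟨ +-comm (n * n) n ⟩
      n + n * n       ≤⟨ +-monoʳ-≤ n (m≤n+m (n * n) n) ⟩
      n + (n + n * n) ≡⟨ cong (n +_) (sym (*-suc n n)) ⟩
      n + n * suc n   <⟨ ≤-refl ⟩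
      suc n * suc n   ≤⟨ *-mono-≤ n<n' n<n' ⟩
      n' * n'         ∎
    where open ≤-Reasoning

  ⟨,⟩-injective : ∀ {s t s' t'} → ⟨ s , t ⟩ ≡ ⟨ s' , t' ⟩ → s ≡ s' × t ≡ t'
  ⟨,⟩-injective {s} {t} {s'} {t'} eq with <-cmp (s + t) (s' + t')
  ... | tri< lt _ _ = ⊥-elim (<⇒≢ (≤-trans (square+offset< (s + t) (s' + t') s (m≤m+n s t) lt) (m≤m+n _ s')) eq)
  ... | tri> _ _ gt = ⊥-elim (<⇒≢ (≤-trans (square+offset< (s' + t') (s + t) s' (m≤m+n s' t') gt) (m≤m+n _ s)) (sym eq))
  ... | tri≈ _ sum≡ _ = s≡s' , +-cancelˡ-≡ s t t' (trans sum≡ (cong (_+ t') (sym s≡s')))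
    where
    s≡s' : s ≡ s'
    s≡s' = +-cancelˡ-≡ ((s + t) * (s + t)) s s' (trans eq (cong (λ z → z * z + s') (sym sum≡)))

  ⟨,⟩-boundˡ : ∀ s t → s ≤ ⟨ s , t ⟩
  ⟨,⟩-boundˡ s t = m≤n+m s _

  ⟨,⟩-boundʳ : ∀ s t → t ≤ ⟨ s , t ⟩
  ⟨,⟩-boundʳ s t = ≤-trans (m≤n+m t s) (≤-trans (n≤n*n (s + t)) (m≤m+n _ s))
    where
    n≤n*n : ∀ n → n ≤ n * n
    n≤n*n zero = z≤n
    n≤n*n (suc n) = m≤m*n (suc n) (suc n)

pairC : Computable 2 (λ v → ⟨ lookup v zero , lookup v (suc zero) ⟩)
pairC = computable-ext (λ { (s ∷ t ∷ []) → sym (⟨,⟩-def s t) }) (compose₂ addC (compose₂ mulC s+t s+t) (projC zero))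
  where
  s+t : Computable 2 (λ v → lookup v zero + lookup v (suc zero))
  s+t = compose₂ addC (projC zero) (projC (suc zero))

dist : ℕ → ℕ → ℕ
dist a b = (a ∸ b) + (b ∸ a)

distC : Computable 2 (λ v → dist (lookup v zero) (lookup v (suc zero)))
distC = compose₂ addC (compose₂ monusC (projC zero) (projC (suc zero))) (compose₂ monusC (projC (suc zero)) (projC zero))

if-equal : ∀ a b u → a ≡ b → if0 (dist a b) u 0 ≡ u
if-equal a .a u refl rewrite n∸n≡0 a = refl

if-unequal : ∀ a b u → a ≢ b → if0 (dist a b) u 0 ≡ 0
if-unequal a b u a≢b with dist a b in d≡
... | zero = ⊥-elim (a≢b (≤-antisym (m∸n≡0⇒m≤n (m+n≡0⇒m≡0 (a ∸ b) d≡)) (m∸n≡0⇒m≤n (m+n≡0⇒n≡0 (a ∸ b) d≡))))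
... | suc _ = refl

sum-zero : ∀ N f → (∀ i → i < N → f i ≡ 0) → sumTo N f ≡ 0
sum-zero zero f zeros = refl
sum-zero (suc N) f zeros rewrite sum-zero N f (λ i i<N → zeros i (m<n⇒m<1+n i<N)) | zeros N ≤-refl = refl

sum-zero⁻¹ : ∀ N f → sumTo N f ≡ 0 → ∀ i → i < N → f i ≡ 0
sum-zero⁻¹ (suc N) f sum≡0 i i<1+N with m≤n⇒m<n∨m≡n (≤-pred i<1+N)
... | inj₁ i<N = sum-zero⁻¹ N f (m+n≡0⇒m≡0 (sumTo N f) sum≡0) i i<N
... | inj₂ refl = m+n≡0⇒n≡0 (sumTo N f) sum≡0

sum-single : ∀ N f i₀ → (∀ i → i ≢ i₀ → f i ≡ 0) → i₀ < N → sumTo N f ≡ f i₀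
sum-single (suc N) f i₀ zeros i₀<1+N with m≤n⇒m<n∨m≡n (≤-pred i₀<1+N)
... | inj₁ i₀<N rewrite sum-single N f i₀ zeros i₀<N | zeros N (λ N≡i₀ → <⇒≢ i₀<N (sym N≡i₀)) = +-identityʳ _
... | inj₂ refl rewrite sum-zero N f (λ i i<N → zeros i (<⇒≢ i<N)) = refl

-- V at the pair coded by x = 1 + ⟨ s , t ⟩, and 0 if x codes no pair; both
-- coordinates are at most x, so a bounded double sum locates the pair
atPair : ℕ → (ℕ → ℕ → ℕ) → ℕ
atPair x V = sumTo (suc x) (λ s → sumTo (suc x) (λ t → if0 (dist x (suc ⟨ s , t ⟩)) (V s t) 0))

atPair-pair : ∀ x V s₀ t₀ → x ≡ suc ⟨ s₀ , t₀ ⟩ → atPair x V ≡ V s₀ t₀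
atPair-pair x V s₀ t₀ x≡ =
  trans (sum-single (suc x) _ s₀ otherRow (s≤s (≤-trans (⟨,⟩-boundˡ s₀ t₀) below-x)))
        (trans (sum-single (suc x) _ t₀ otherColumn (s≤s (≤-trans (⟨,⟩-boundʳ s₀ t₀) below-x)))
               (if-equal x _ _ x≡))
  where
  below-x : ⟨ s₀ , t₀ ⟩ ≤ x
  below-x = subst (⟨ s₀ , t₀ ⟩ ≤_) (sym x≡) (n≤1+n _)
  otherRow : ∀ s → s ≢ s₀ → sumTo (suc x) (λ t → if0 (dist x (suc ⟨ s , t ⟩)) (V s t) 0) ≡ 0
  otherRow s s≢s₀ = sum-zero (suc x) _ (λ t _ →
    if-unequal x _ _ (λ x≡′ → s≢s₀ (proj₁ (⟨,⟩-injective (suc-injective (trans (sym x≡′) x≡))))))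
  otherColumn : ∀ t → t ≢ t₀ → if0 (dist x (suc ⟨ s₀ , t ⟩)) (V s₀ t) 0 ≡ 0
  otherColumn t t≢t₀ = if-unequal x _ _ (λ x≡′ → t≢t₀ (proj₂ (⟨,⟩-injective (suc-injective (trans (sym x≡′) x≡)))))

atPair-none : ∀ x V → (∀ s t → x ≢ suc ⟨ s , t ⟩) → atPair x V ≡ 0
atPair-none x V unpaired = sum-zero (suc x) _ (λ s _ → sum-zero (suc x) _ (λ t _ → if-unequal x _ _ (unpaired s t)))

atPairC : ∀ {V : ℕ → ℕ → ℕ} → Computable 3 (λ v → V (lookup v (suc zero)) (lookup v zero)) →
          Computable 1 (λ v → atPair (lookup v zero) V)
atPairC {V} VC = computable-ext (λ { (x ∷ []) → refl }) (compose₂ rowsC (compose₁ succC (projC zero)) (projC zero))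
  where
  term : ℕ → ℕ → ℕ → ℕ
  term x s t = if0 (dist x (suc ⟨ s , t ⟩)) (V s t) 0
  -- arguments (t , s , x)
  termC : Computable 3 (λ v → term (lookup v (suc (suc zero))) (lookup v (suc zero)) (lookup v zero))
  termC = ifZeroC (compose₂ distC (projC (suc (suc zero))) (compose₁ succC (compose₂ pairC (projC (suc zero)) (projC zero))))
                  VC (constC 0)
  -- arguments (N , s , x)
  columnsC : Computable 3 (λ v → sumTo (lookup v zero) (λ t → term (lookup v (suc (suc zero))) (lookup v (suc zero)) t))
  columnsC = computable-ext (λ { (N ∷ s ∷ x ∷ []) → refl })
    (sumC {F = λ t w → term (lookup w (suc zero)) (lookup w zero) t} (computable-ext (λ { (t ∷ s ∷ x ∷ []) → refl }) termC))
  -- arguments (N , x)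
  rowsC : Computable 2 (λ v → sumTo (lookup v zero) (λ s → sumTo (suc (lookup v (suc zero))) (term (lookup v (suc zero)) s)))
  rowsC = computable-ext (λ { (N ∷ x ∷ []) → refl })
    (sumC {F = λ s w → sumTo (suc (lookup w zero)) (term (lookup w zero) s)}
      (computable-ext (λ { (s ∷ x ∷ []) → refl })
        (compose₃ columnsC (compose₁ succC (projC (suc zero))) (projC zero) (projC (suc zero)))))

-- An injective coding of terms by natural numbers

data Tree : Set where
  leaf : ℕ → Tree
  node : Tree → Tree → Tree

leaf-injective : ∀ {k k'} → leaf k ≡ leaf k' → k ≡ k'
leaf-injective refl = refl

node-injective : ∀ {l r l' r'} → node l r ≡ node l' r' → l ≡ l' × r ≡ r'
node-injective refl = refl , refl

mutual
  toTree : ∀ {n} → PR n → Tree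
  toTree zer = leaf 0
  toTree succ = leaf 1
  toTree (proj i) = node (leaf 2) (leaf (toℕ i))
  toTree (comp {m} f gs) = node (leaf 3) (node (leaf m) (node (toTree f) (toTrees gs)))
  toTree (prec g h) = node (leaf 4) (node (toTree g) (toTree h))
  toTree (mu f) = node (leaf 5) (toTree f)

  toTrees : ∀ {n m} → Vec (PR n) m → Tree
  toTrees [] = leaf 0
  toTrees (g ∷ gs) = node (toTree g) (toTrees gs)

-- distinct constructors have trees with distinct roots, so only the diagonal
-- cases need an argument
mutual
  toTree-injective : ∀ {n} (f f' : PR n) → toTree f ≡ toTree f' → f ≡ f'
  toTree-injective zer zer eq = refl
  toTree-injective succ succ eq = refl
  toTree-injective (proj i) (proj i') eq = cong proj (toℕ-injective (leaf-injective (proj₂ (node-injective eq))))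
  toTree-injective (comp {m} f gs) (comp {m'} f' gs') eq
    with node-injective (proj₂ (node-injective eq))
  ... | refl , fgs≡ with node-injective fgs≡
  ... | f≡ , gs≡ = cong₂ comp (toTree-injective f f' f≡) (toTrees-injective gs gs' gs≡)
  toTree-injective (prec g h) (prec g' h') eq with node-injective (proj₂ (node-injective eq))
  ... | g≡ , h≡ = cong₂ prec (toTree-injective g g' g≡) (toTree-injective h h' h≡)
  toTree-injective (mu f) (mu f') eq = cong mu (toTree-injective f f' (proj₂ (node-injective eq)))

  toTrees-injective : ∀ {n m} (gs gs' : Vec (PR n) m) → toTrees gs ≡ toTrees gs' → gs ≡ gs'
  toTrees-injective [] [] eq = refl
  toTrees-injective (g ∷ gs) (g' ∷ gs') eq with node-injective eq
  ... | g≡ , gs≡ = cong₂ _∷_ (toTree-injective g g' g≡) (toTrees-injective gs gs' gs≡)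

-- trees coded by nested pairs, the first component telling leaves from nodes
treeCode : Tree → ℕ
treeCode (leaf k) = ⟨ 0 , k ⟩
treeCode (node l r) = ⟨ suc (treeCode l) , treeCode r ⟩

treeCode-injective : ∀ (τ τ' : Tree) → treeCode τ ≡ treeCode τ' → τ ≡ τ'
treeCode-injective (leaf k) (leaf k') eq = cong leaf (proj₂ (⟨,⟩-injective eq))
treeCode-injective (leaf k) (node l' r') eq with ⟨,⟩-injective eq
... | () , _
treeCode-injective (node l r) (leaf k') eq with ⟨,⟩-injective eq
... | () , _
treeCode-injective (node l r) (node l' r') eq with ⟨,⟩-injective eq
... | l≡ , r≡ = cong₂ node (treeCode-injective l l' (suc-injective l≡)) (treeCode-injective r r' r≡)

code : ∀ {n} → PR n → ℕ
code f = treeCode (toTree f)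

code-injective : ∀ {n} (f f' : PR n) → code f ≡ code f' → f ≡ f'
code-injective f f' eq = toTree-injective f f' (treeCode-injective (toTree f) (toTree f') eq)

Least : (ℕ → Set) → ℕ → Set
Least P m = P m × (∀ m' → m' < m → ¬ P m')

least-unique : ∀ {P Q : ℕ → Set} {m m'} → (∀ n → P n → Q n) → (∀ n → Q n → P n) →
               Least P m → Least Q m' → m ≡ m'
least-unique {m = m} {m'} P⇒Q Q⇒P (Pm , belowm) (Qm' , belowm') with <-cmp m m'
... | tri< m<m' _ _ = ⊥-elim (belowm' m m<m' (P⇒Q m Pm))
... | tri≈ _ m≡m' _ = m≡m'
... | tri> _ _ m'<m = ⊥-elim (belowm m' m'<m (Q⇒P m' Qm'))

search-below : ∀ {P : ℕ → Set} → (∀ n → Dec (P n)) → ∀ K → Σ ℕ (Least P) ⊎ (∀ m → m < K → ¬ P m)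
search-below P? zero = inj₂ (λ m ())
search-below {P} P? (suc K) with search-below P? K
... | inj₁ least = inj₁ least
... | inj₂ none with P? K
...   | yes PK = inj₁ (K , PK , none)
...   | no ¬PK = inj₂ (λ m m<1+K → case m (m≤n⇒m<n∨m≡n (≤-pred m<1+K)))
  where
  case : ∀ m → m < K ⊎ m ≡ K → ¬ P m
  case m (inj₁ m<K) = none m m<K
  case m (inj₂ refl) = ¬PK

least-witness : ∀ {P : ℕ → Set} → (∀ n → Dec (P n)) → ∀ K → P K → Σ ℕ (Least P)
least-witness P? K PK with search-below P? (suc K)
... | inj₁ least = least
... | inj₂ none = ⊥-elim (none K ≤-refl PK)

-- The recursive set of first halting stages of a code e

module HaltingStages (e : PRFun) where

  HaltsWithin : ℕ → ℕ → Set
  HaltsWithin s t = eval e t (s ∷ []) ≢ 0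

  halts-within? : ∀ s t → Dec (HaltsWithin s t)
  halts-within? s t with eval e t (s ∷ [])
  ... | zero = no (λ ≢0 → ≢0 refl)
  ... | suc _ = yes (λ ())

  FirstStage : ℕ → ℕ → Set
  FirstStage s = Least (HaltsWithin s)

  first-stage-exists : ∀ {s} → e ↓ s → Σ ℕ (FirstStage s)
  first-stage-exists (y , e⇓y) =
    let (K , eval≡) = eval-complete e⇓y in least-witness (halts-within? _) K (λ eval≡0 → 0≢1+n (trans (sym eval≡0) eval≡))

  first-stage-unique : ∀ {s t t'} → FirstStage s t → FirstStage s t' → t ≡ t'
  first-stage-unique = least-unique (λ _ h → h) (λ _ h → h)

  first-stage-halts : ∀ {s t} → FirstStage s t → e ↓ s
  first-stage-halts {s} {t} (halts , _) with eval e t (s ∷ []) in eval≡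
  ... | zero = ⊥-elim (halts refl)
  ... | suc y = y , eval-sound e t (s ∷ []) y eval≡

  firstStage : ℕ → ℕ → ℕ
  firstStage s t = if0 (eval e t (s ∷ [])) 0 (if0 (sumTo t (λ t' → eval e t' (s ∷ []))) 1 0)

  firstStage-spec : ∀ s t → (FirstStage s t × firstStage s t ≡ 1) ⊎ (¬ FirstStage s t × firstStage s t ≡ 0)
  firstStage-spec s t with eval e t (s ∷ [])
  ... | zero = inj₂ ((λ (halts , _) → halts refl) , refl)
  ... | suc _ with sumTo t (λ t' → eval e t' (s ∷ [])) in sum≡
  ...   | zero = inj₁ (((λ ()) , λ t' t'<t halts → halts (sum-zero⁻¹ t _ sum≡ t' t'<t)) , refl)
  ...   | suc _ = inj₂ ((λ (_ , earlier) → 0≢1+n (trans (sym (sum-zero t _ (λ t' t'<t → not-halts t' (earlier t' t'<t)))) sum≡)) , refl)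
    where
    not-halts : ∀ t' → ¬ HaltsWithin s t' → eval e t' (s ∷ []) ≡ 0
    not-halts t' ¬halts with eval e t' (s ∷ [])
    ... | zero = refl
    ... | suc _ = ⊥-elim (¬halts (λ ()))

  firstStageC : Computable 3 (λ v → firstStage (lookup v (suc zero)) (lookup v zero))
  firstStageC = ifZeroC (compose₂ (eval-computable e) (projC zero) (projC (suc zero))) (constC 0)
    (ifZeroC (compose₂ (sumC {F = λ t' w → eval e t' w} (eval-computable e)) (projC zero) (projC (suc zero)))
             (constC 1) (constC 0))

  T : ℕ → Set
  T x = Σ ℕ λ s → Σ ℕ λ t → (x ≡ suc ⟨ s , t ⟩) × FirstStage s t

  χT : ℕ → ℕ
  χT x = atPair x firstStage

  -- excluded middle is only used to decide whether x codes a pair at all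
  χT-spec : ExcludedMiddle 0ℓ → ∀ x → (T x × χT x ≡ 1) ⊎ (¬ T x × χT x ≡ 0)
  χT-spec lem x with lem {Σ ℕ λ s → Σ ℕ λ t → x ≡ suc ⟨ s , t ⟩}
  ... | no unpaired = inj₂ ((λ (s , t , x≡ , _) → unpaired (s , t , x≡)) ,
                            atPair-none x firstStage (λ s t x≡ → unpaired (s , t , x≡)))
  ... | yes (s , t , x≡) with firstStage-spec s t
  ...   | inj₁ (first , is1) = inj₁ ((s , t , x≡ , first) , trans (atPair-pair x _ s t x≡) is1)
  ...   | inj₂ (¬first , is0) = inj₂ (not-T , trans (atPair-pair x _ s t x≡) is0)
    where
    not-T : ¬ T x
    not-T (s' , t' , x≡′ , first') with ⟨,⟩-injective (suc-injective (trans (sym x≡) x≡′))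
    ... | refl , refl = ¬first first'

  χTC : Computable 1 (λ v → χT (lookup v zero))
  χTC = atPairC firstStageC

  χT⇓ : ∀ x {b} → χT x ≡ b → proj₁ χTC ⟦ x ∷ [] ⟧⇓ b
  χT⇓ x χ≡ = subst (proj₁ χTC ⟦ x ∷ [] ⟧⇓_) χ≡ (proj₂ χTC (x ∷ []))

  T-recursive : ExcludedMiddle 0ℓ → Recursive T
  T-recursive lem = proj₁ χTC , λ x →
    map-⊎ (λ (Tx , χ≡) → Tx , χT⇓ x χ≡) (λ (¬Tx , χ≡) → ¬Tx , χT⇓ x χ≡) (χT-spec lem x)

  decode : ℕ → ℕ
  decode x = atPair x (λ s t → s)

  decodeC : Computable 1 (λ v → decode (lookup v zero))
  decodeC = atPairC (projC (suc zero))

  decode⇓ : ∀ s t → proj₁ decodeC ⟦ suc ⟨ s , t ⟩ ∷ [] ⟧⇓ s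
  decode⇓ s t = subst (proj₁ decodeC ⟦ suc ⟨ s , t ⟩ ∷ [] ⟧⇓_) (atPair-pair _ (λ s t → s) s t refl) (proj₂ decodeC _)

≈-refl : ∀ {α} → α ≈PR α
≈-refl x y = (λ d → d) , (λ d → d)

≈-sym : ∀ {α β} → α ≈PR β → β ≈PR α
≈-sym α≈β x y = proj₂ (α≈β x y) , proj₁ (α≈β x y)

≈-trans : ∀ {α β γ} → α ≈PR β → β ≈PR γ → α ≈PR γ
≈-trans α≈β β≈γ x y = (λ d → proj₁ (β≈γ x y) (proj₁ (α≈β x y) d)) , (λ d → proj₂ (α≈β x y) (proj₂ (β≈γ x y) d))

module Construction
  (lem : ExcludedMiddle 0ℓ) (S : ℕ → Set) (A : PRFun → Set)
  (e : PRFun) (S-dom : ∀ x → (S x → e ↓ x) × (e ↓ x → S x))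
  (defined : ∀ α → A α → ∀ s → S s → α ↓ s)
  where

  open HaltingStages e

  stage : ∀ s → S s → Σ ℕ (FirstStage s)
  stage s q = first-stage-exists (proj₁ (S-dom s) q)

  stage-state : ∀ {s t} → FirstStage s t → S s
  stage-state first = proj₂ (S-dom _) (first-stage-halts first)

  φ : (s : ℕ) → S s → ℕ
  φ s q = suc ⟨ s , proj₁ (stage s q) ⟩

  φ-wd : ∀ s (p q : S s) → φ s p ≡ φ s q
  φ-wd s p q = cong (λ t → suc ⟨ s , t ⟩) (first-stage-unique (proj₂ (stage s p)) (proj₂ (stage s q)))

  φ-surj : ∀ x → T x → Σ ℕ λ s → Σ (S s) λ p → φ s p ≡ x
  φ-surj x (s , t , x≡ , first) = s , stage-state first ,
    trans (cong (λ t → suc ⟨ s , t ⟩) (first-stage-unique (proj₂ (stage s (stage-state first))) first))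
          (sym x≡)

  CodeOf : PRFun → ℕ → Set
  CodeOf α m = Σ PRFun λ β → (code β ≡ m) × (β ≈PR α)

  leastCode : (α : PRFun) → Σ ℕ (Least (CodeOf α))
  leastCode α = least-witness (λ _ → lem) (code α) (α , refl , ≈-refl)

  -- the least such code: an invariant of the extensional class of α that
  -- determines the class
  index : PRFun → ℕ
  index α = proj₁ (leastCode α)

  index-wd : ∀ {α α'} → α ≈PR α' → index α ≡ index α'
  index-wd α≈α' = least-unique (λ m (β , β≡ , β≈α) → β , β≡ , ≈-trans β≈α α≈α')
                               (λ m (β , β≡ , β≈α') → β , β≡ , ≈-trans β≈α' (≈-sym α≈α'))
                               (proj₂ (leastCode _)) (proj₂ (leastCode _))

  index-injective : ∀ {α α'} → index α ≡ index α' → α ≈PR α'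
  index-injective {α} {α'} index≡ with proj₁ (proj₂ (leastCode α)) | proj₁ (proj₂ (leastCode α'))
  ... | β , β≡ , β≈α | β' , β'≡ , β'≈α' with code-injective β β' (trans β≡ (trans index≡ (sym β'≡)))
  ...   | refl = ≈-trans (≈-sym β≈α) β'≈α'

  valueAt : ∀ α → A α → ∀ x → Dec (T x) → ℕ
  valueAt α p x (yes (s , t , _ , first)) = proj₁ (defined α p s (stage-state first))
  valueAt α p x (no _) = index α

  ψ : (α : PRFun) → A α → ℕ → ℕ
  ψ α p x = valueAt α p x lem

  ψ-at-state : ∀ α p s (q : S s) → α ⟦ s ∷ [] ⟧⇓ ψ α p (φ s q)
  ψ-at-state α p s q with lem {T (φ s q)}
  ... | no ¬T = ⊥-elim (¬T (s , _ , refl , proj₂ (stage s q)))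
  ... | yes (s' , t' , x≡ , first) with proj₁ (⟨,⟩-injective (suc-injective x≡))
  ...   | refl = proj₂ (defined α p s (stage-state first))

  -- 0 codes no pair, so ψ α 0 is the index of α
  ψ-off-T : ∀ α p → ψ α p 0 ≡ index α
  ψ-off-T α p with lem {T 0}
  ... | yes (_ , _ , () , _)
  ... | no _ = refl

  -- ψ respects extensional equality: on T by determinism, off T by index-wd
  ψ-wd : ∀ α α' (p : A α) (p' : A α') → α ≈PR α' → ∀ x → ψ α p x ≡ ψ α' p' x
  ψ-wd α α' p p' α≈α' x with lem {T x}
  ... | yes (s , t , _ , first) = ⇓-deterministic (proj₁ (α≈α' s _) (proj₂ (defined α p s (stage-state first))))
                                                  (proj₂ (defined α' p' s (stage-state first)))
  ... | no _ = index-wd α≈α'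

  -- ψ reflects extensional equality through its value at 0
  ψ-inj : ∀ α α' (p : A α) (p' : A α') → (∀ x → ψ α p x ≡ ψ α' p' x) → α ≈PR α'
  ψ-inj α α' p p' ψ≡ = index-injective (trans (sym (ψ-off-T α p)) (trans (ψ≡ 0) (ψ-off-T α' p')))

  B : (ℕ → ℕ) → Set
  B f = Σ PRFun λ α → Σ (A α) λ p → ∀ x → ψ α p x ≡ f x

  -- "if χT x = 0 then index α else α (decode x)", branching by primitive
  -- recursion on χT x ∈ {0 , 1}
  ψCode : PRFun → PRFun
  ψCode α = comp (prec (proj₁ (constC (index α))) (comp α (comp (proj₁ decodeC) (proj (suc (suc zero)) ∷ []) ∷ [])))
                 (proj₁ χTC ∷ proj zero ∷ [])

  ψCode⇓ : ∀ α p x → ψCode α ⟦ x ∷ [] ⟧⇓ ψ α p x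
  ψCode⇓ α p x with lem {T x} | χT-spec lem x
  ... | yes (s , t , refl , first) | inj₁ (_ , χ≡1) =
    ev-comp (ev-∷ (χT⇓ x χ≡1) (ev-∷ ev-proj ev-[]))
      (ev-precS (ev-prec0 (proj₂ (constC (index α)) (x ∷ [])))
                (ev-comp (ev-∷ (ev-comp (ev-∷ ev-proj ev-[]) (decode⇓ s t)) ev-[])
                         (proj₂ (defined α p s (stage-state first)))))
  ... | yes Tx | inj₂ (¬Tx , _) = ⊥-elim (¬Tx Tx)
  ... | no ¬Tx | inj₁ (Tx , _) = ⊥-elim (¬Tx Tx)
  ... | no _ | inj₂ (_ , χ≡0) =
    ev-comp (ev-∷ (χT⇓ x χ≡0) (ev-∷ ev-proj ev-[])) (ev-prec0 (proj₂ (constC (index α)) (x ∷ [])))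

  B-computable : ∀ f → B f → TotalRecursive f
  B-computable f (α , p , ψ≡f) = ψCode α , λ x → subst (ψCode α ⟦ x ∷ [] ⟧⇓_) (ψ≡f x) (ψCode⇓ α p x)

  isomorphism : Isomorphic S A T B
  isomorphism = record
    { φ      = φ
    ; φ-wd   = φ-wd
    ; φ-into = λ s q → s , _ , refl , proj₂ (stage s q)
    ; φ-inj  = λ s s' q q' φ≡ → proj₁ (⟨,⟩-injective (suc-injective φ≡))
    ; φ-surj = φ-surj
    ; ψ      = ψ
    ; ψ-wd   = ψ-wd
    ; ψ-into = λ α p → α , p , λ _ → refl
    ; ψ-inj  = ψ-inj
    ; ψ-surj = λ f Bf → Bf
    ; compat = ψ-at-state
    }

theorem3 : ExcludedMiddle 0ℓ →
    (S : ℕ → Set) (A : PRFun → Set) →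
    RecEnum S →
    (∀ α → A α → ∀ s → S s → α ↓ s) →
    Σ (ℕ → Set) λ T → Σ ((ℕ → ℕ) → Set) λ B →
      IsComputableModel T B × Isomorphic S A T B
theorem3 lem S A (e , S-dom) defined =
  T , B , (T-recursive lem , B-computable) , isomorphism
  where
  open Construction lem S A e S-dom defined
  open HaltingStages e
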